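{- The class of maximal residuated lattices is closed under finite direct products: if $A_1,\ldots,A_n$ are maximal residuated lattices, then $\prod_{i=1}^n A_i$ is maximal.
   Context: A residuated lattice is a commutative integral residuated bounded lattice $(A,\vee,\wedge,\odot,\rightarrow,0,1)$ (bounded lattice, commutative monoid $(A,\odot,1)$, $a\le b\rightarrow c$ iff $a\odot b\le c$); products have componentwise operations. A filter is a nonempty subset closed under $\odot$ and upward closed. For a filter $F$, $a\equiv b\pmod F$ iff $(a\rightarrow b)\wedge(b\rightarrow a)\in F$. $A$ is maximal iff whenever $\{(a_i,F_i)\}_{i\in I}$ ($a_i\in A$, $F_i$ filters) is such that every finite subfamily of the congruences $x\equiv a_i\pmod{F_i}$ has a common solution in $A$, the whole family has a common solution in $A$. -}

module Defs where

open import Level using (Level; _⊔_; suc)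
open import Data.Product using (Σ; ∃; _×_; _,_; proj₁; proj₂)
open import Data.Fin using (Fin)
open import Data.List using (List)
open import Data.List.Membership.Propositional using (_∈_)
open import Function.Bundles using (_⇔_; mk⇔; Equivalence)
open import Relation.Unary using (Pred)
open import Relation.Binary.Core using (Rel)
open import Relation.Binary.Structures using (IsEquivalence; IsPreorder; IsPartialOrder)
open import Relation.Binary.Lattice.Structures using (IsLattice; IsBoundedLattice)
open import Algebra.Core using (Op₂)
open import Algebra.Structures using (IsMagma; IsSemigroup; IsMonoid; IsCommutativeMonoid)

-- Residuated lattices: commutative integral residuated bounded lattices
-- (A, ∨, ∧, ⊙, ⇒, 0, 1): a bounded lattice (as a poset with sup/inf,
-- w.r.t. a setoid equality _≈_), (A, ⊙, 1) a commutative monoid whose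
-- unit 1 is the top element, and  a ≤ b ⇒ c  iff  a ⊙ b ≤ c.

record ResiduatedLattice (c ℓ₁ ℓ₂ : Level) : Set (suc (c ⊔ ℓ₁ ⊔ ℓ₂)) where
  infixr 6 _∨_
  infixr 7 _∧_
  infixr 7 _⊙_
  infixr 5 _⇒_
  field
    Carrier : Set c
    _≈_     : Rel Carrier ℓ₁
    _≤_     : Rel Carrier ℓ₂
    _∨_     : Op₂ Carrier
    _∧_     : Op₂ Carrier
    _⊙_     : Op₂ Carrier
    _⇒_     : Op₂ Carrier
    𝟘       : Carrier
    𝟙       : Carrier
    isBoundedLattice    : IsBoundedLattice _≈_ _≤_ _∨_ _∧_ 𝟙 𝟘
    isCommutativeMonoid : IsCommutativeMonoid _≈_ _⊙_ 𝟙
    residuation         : ∀ a b c → (a ≤ (b ⇒ c)) ⇔ ((a ⊙ b) ≤ c)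

module _ {c ℓ₁ ℓ₂ : Level} (A : ResiduatedLattice c ℓ₁ ℓ₂) where
  open ResiduatedLattice A

  record IsFilter {f : Level} (F : Pred Carrier f) : Set (c ⊔ ℓ₂ ⊔ f) where
    field
      nonempty : Σ Carrier F
      ⊙-closed : ∀ {a b} → F a → F b → F (a ⊙ b)
      up-closed : ∀ {a b} → a ≤ b → F a → F b

  _≡_mod_ : {f : Level} → Carrier → Carrier → Pred Carrier f → Set f
  a ≡ b mod F = F ((a ⇒ b) ∧ (b ⇒ a))

  Maximal : (ι f : Level) → Set (c ⊔ ℓ₂ ⊔ suc ι ⊔ suc f)
  Maximal ι f =
    (I : Set ι) (a : I → Carrier) (F : I → Pred Carrier f) →
    (∀ i → IsFilter (F i)) →
    (∀ (J : List I) → Σ Carrier λ x → ∀ {i} → i ∈ J → x ≡ a i mod F i) →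
    Σ Carrier λ x → ∀ i → x ≡ a i mod F i

module _ {c ℓ₁ ℓ₂ : Level} {n : _} (A : Fin n → ResiduatedLattice c ℓ₁ ℓ₂) where
  open ResiduatedLattice

  private
    C : Set c
    C = (i : Fin n) → Carrier (A i)
    _≈ₚ_ : Rel C ℓ₁
    x ≈ₚ y = ∀ i → _≈_ (A i) (x i) (y i)
    _≤ₚ_ : Rel C ℓ₂
    x ≤ₚ y = ∀ i → _≤_ (A i) (x i) (y i)
    lift₂ : (∀ i → Op₂ (Carrier (A i))) → Op₂ C
    lift₂ op x y i = op i (x i) (y i)

    module BL i = IsBoundedLattice (isBoundedLattice (A i))
    module CM i = IsCommutativeMonoid (isCommutativeMonoid (A i))

    isEq : IsEquivalence _≈ₚ_
    isEq = record
      { refl  = λ i → CM.refl i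
      ; sym   = λ p i → CM.sym i (p i)
      ; trans = λ p q i → CM.trans i (p i) (q i) }

    isPO : IsPartialOrder _≈ₚ_ _≤ₚ_
    isPO = record
      { isPreorder = record
          { isEquivalence = isEq
          ; reflexive = λ p i → BL.reflexive i (p i)
          ; trans = λ p q i → BL.trans i (p i) (q i) }
      ; antisym = λ p q i → BL.antisym i (p i) (q i) }

  ∏ : ResiduatedLattice c ℓ₁ ℓ₂
  ∏ = record
    { Carrier = C
    ; _≈_ = _≈ₚ_
    ; _≤_ = _≤ₚ_
    ; _∨_ = lift₂ (λ i → _∨_ (A i))
    ; _∧_ = lift₂ (λ i → _∧_ (A i))
    ; _⊙_ = lift₂ (λ i → _⊙_ (A i))
    ; _⇒_ = lift₂ (λ i → _⇒_ (A i))
    ; 𝟘 = λ i → 𝟘 (A i)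
    ; 𝟙 = λ i → 𝟙 (A i)
    ; isBoundedLattice = record
        { isLattice = record
            { isPartialOrder = isPO
            ; supremum = λ x y →
                (λ i → BL.x≤x∨y i (x i) (y i)) ,
                (λ i → BL.y≤x∨y i (x i) (y i)) ,
                (λ z p q i → BL.∨-least i (p i) (q i))
            ; infimum = λ x y →
                (λ i → BL.x∧y≤x i (x i) (y i)) ,
                (λ i → BL.x∧y≤y i (x i) (y i)) ,
                (λ z p q i → BL.∧-greatest i (p i) (q i)) }
        ; maximum = λ x i → BL.maximum i (x i)
        ; minimum = λ x i → BL.minimum i (x i) }
    ; isCommutativeMonoid = record
        { isMonoid = record
            { isSemigroup = record
                { isMagma = record
                    { isEquivalence = isEq
                    ; ∙-cong = λ p q i → CM.∙-cong i (p i) (q i) }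
                ; assoc = λ x y z i → CM.assoc i (x i) (y i) (z i) }
            ; identity = (λ x i → proj₁ (CM.identity i) (x i))
                       , (λ x i → proj₂ (CM.identity i) (x i)) }
        ; comm = λ x y i → CM.comm i (x i) (y i) }
    ; residuation = λ a b d → mk⇔
        (λ p i → Equivalence.to (residuation (A i) (a i) (b i) (d i)) (p i))
        (λ p i → Equivalence.from (residuation (A i) (a i) (b i) (d i)) (p i))
    }

module Submission where

-- A filter F of A₁ × ⋯ × Aₙ is determined by its component filters
-- Fₖ = { y | ιₖ y ∈ F }, where ιₖ y is y in position k and 𝟙 elsewhere:
-- t ∈ F iff tₖ ∈ Fₖ for every k, because t lies above ιₖ tₖ and above the
-- finite product ⊙ₖ ιₖ tₖ.  Since implication and meet are componentwise,
-- a system of congruences in the product splits into n independent systems,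
-- one in each Aₖ, which are solved by maximality of Aₖ.

open import Defs
open import Level using (Level)
open import Data.Nat using (ℕ)
open import Data.Fin using (Fin; _≟_)
open import Data.List using (List; []; _∷_; allFin)
open import Data.List.Membership.Propositional using (_∈_)
open import Data.List.Membership.Propositional.Properties using (∈-allFin)
open import Data.List.Relation.Unary.Any using (here; there)
open import Data.Product using (Σ; _,_; proj₁; proj₂)
open import Relation.Nullary using (yes; no; contradiction)
open import Relation.Binary.PropositionalEquality using (refl)
open import Relation.Binary.Lattice.Structures using (IsBoundedLattice)
open import Algebra.Structures using (IsCommutativeMonoid)
open import Function.Bundles using (_⇔_; mk⇔; Equivalence)

open ResiduatedLattice

module Integral {c ℓ₁ ℓ₂ : Level} (R : ResiduatedLattice c ℓ₁ ℓ₂) where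
  private
    module BL = IsBoundedLattice (isBoundedLattice R)
    module CM = IsCommutativeMonoid (isCommutativeMonoid R)

  x⊙y≤y : ∀ x y → _≤_ R (_⊙_ R x y) y
  x⊙y≤y x y = Equivalence.to (residuation R x y y)
    (BL.trans (BL.maximum x)
      (Equivalence.from (residuation R (𝟙 R) y y) (BL.reflexive (CM.identityˡ y))))

  x⊙y≤x : ∀ x y → _≤_ R (_⊙_ R x y) x
  x⊙y≤x x y = BL.trans (BL.reflexive (CM.comm x y)) (x⊙y≤y y x)

  𝟙∈filter : ∀ {f} {F : Carrier R → Set f} → IsFilter R F → F (𝟙 R)
  𝟙∈filter isF = IsFilter.up-closed isF (BL.maximum _) (proj₂ (IsFilter.nonempty isF))

module Product {c ℓ₁ ℓ₂ : Level} {n : ℕ} (A : Fin n → ResiduatedLattice c ℓ₁ ℓ₂) where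
  private
    module BL i = IsBoundedLattice (isBoundedLattice (A i))
    P = ∏ A
    C = Carrier P

  embed : (k : Fin n) → Carrier (A k) → C
  embed k y j with k ≟ j
  ... | yes refl = y
  ... | no _ = 𝟙 (A j)

  ≤-embed : (t : C) (k : Fin n) → _≤_ P t (embed k (t k))
  ≤-embed t k j with k ≟ j
  ... | yes refl = BL.refl k
  ... | no _ = BL.maximum j (t j)

  embed-⊙ : (k : Fin n) (x y : Carrier (A k)) →
    _≤_ P (_⊙_ P (embed k x) (embed k y)) (embed k (_⊙_ (A k) x y))
  embed-⊙ k x y j with k ≟ j
  ... | yes refl = BL.refl k
  ... | no _ = BL.maximum j _

  embed-mono : (k : Fin n) {x y : Carrier (A k)} → _≤_ (A k) x y →
    _≤_ P (embed k x) (embed k y)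
  embed-mono k x≤y j with k ≟ j
  ... | yes refl = x≤y
  ... | no _ = BL.refl j

  embed-diagonal : (k : Fin n) (y : Carrier (A k)) → _≤_ (A k) (embed k y k) y
  embed-diagonal k y with k ≟ k
  ... | yes refl = BL.refl k
  ... | no k≢k = contradiction refl k≢k

  ⨀embed : C → List (Fin n) → C
  ⨀embed t [] = 𝟙 P
  ⨀embed t (k ∷ ks) = _⊙_ P (embed k (t k)) (⨀embed t ks)

  ⨀embed-≤ : (t : C) (ks : List (Fin n)) {j : Fin n} → j ∈ ks →
    _≤_ (A j) (⨀embed t ks j) (t j)
  ⨀embed-≤ t (j ∷ ks) (here refl) =
    BL.trans j (Integral.x⊙y≤x (A j) _ _) (embed-diagonal j (t j))
  ⨀embed-≤ t (k ∷ ks) {j} (there j∈ks) =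
    BL.trans j (Integral.x⊙y≤y (A j) _ _) (⨀embed-≤ t ks j∈ks)

  module _ {f : Level} {F : C → Set f} (isF : IsFilter P F) where
    open IsFilter isF

    component : (k : Fin n) → Carrier (A k) → Set f
    component k y = F (embed k y)

    component-isFilter : (k : Fin n) → IsFilter (A k) (component k)
    component-isFilter k = record
      { nonempty  = 𝟙 (A k) , up-closed (≤-embed (𝟙 P) k) (Integral.𝟙∈filter P isF)
      ; ⊙-closed  = λ {x} {y} Fx Fy → up-closed (embed-⊙ k x y) (⊙-closed Fx Fy)
      ; up-closed = λ x≤y → up-closed (embed-mono k x≤y) }

    ⨀embed∈F : (t : C) → (∀ k → component k (t k)) → ∀ ks → F (⨀embed t ks)
    ⨀embed∈F t Fₖt [] = Integral.𝟙∈filter P isF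
    ⨀embed∈F t Fₖt (k ∷ ks) = ⊙-closed (Fₖt k) (⨀embed∈F t Fₖt ks)

    ∈F⇔∈components : (t : C) → F t ⇔ (∀ k → component k (t k))
    ∈F⇔∈components t = mk⇔
      (λ Ft k → up-closed (≤-embed t k) Ft)
      (λ Fₖt → up-closed (λ j → ⨀embed-≤ t (allFin n) (∈-allFin j))
                         (⨀embed∈F t Fₖt (allFin n)))

proposition6p4 : {c ℓ₁ ℓ₂ : Level} (ι f : Level) (n : ℕ)
    (A : Fin n → ResiduatedLattice c ℓ₁ ℓ₂) →
    (∀ i → Maximal (A i) ι f) →
    Maximal (∏ A) ι f
proposition6p4 ι f n A maximal I a F isF finitelySolvable =
  x , λ i → Equivalence.from (∈F⇔∈components (isF i) _) (λ k → proj₂ (solution k) i)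
  where
  open Product A

  solution : (k : Fin n) →
    Σ (Carrier (A k)) λ y → ∀ i → _≡_mod_ (A k) y (a i k) (component (isF i) k)
  solution k = maximal k I (λ i → a i k) (λ i → component (isF i) k)
    (λ i → component-isFilter (isF i) k)
    (λ J → let (z , z≡a) = finitelySolvable J in
      z k , λ i∈J → Equivalence.to (∈F⇔∈components (isF _) _) (z≡a i∈J) k)

  x : Carrier (∏ A)
  x k = proj₁ (solution k)
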